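{- (i) $\bar{R}(4;6)=5$. (ii) $\bar{R}(5;k)=6$ for $8\le k\le 10$. (iii) $\bar{R}(6;8)=11$, $\bar{R}(6;10)=8$, and $\bar{R}(6;k)=7$ for $11\le k\le 15$.
   Context: For a positive integer $n$, $[n]=\{1,\dots,n\}$. An edge-coloring of $K_n$ with $k$ colors is a map $f:\binom{[n]}{2}\to[k]$; for $i\in[k]$, $\alpha_i(f)$ is the independence number of the graph on $[n]$ whose edges are the pairs of color $i$. For positive integers $m_1,\dots,m_k$, $\bar{R}(m_1,\dots,m_k)$ is the least positive integer $n$ such that for every edge-coloring $f$ of $K_n$ with $k$ colors there exists $i\in[k]$ with $\alpha_i(f)\ge m_i$. $\bar{R}(m;k)$ denotes $\bar{R}(m,m,\dots,m)$ with $k$ arguments. -}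

module Defs where

open import Data.Nat using (ℕ; _≤_; _<_)
open import Data.Fin using (Fin)
open import Data.Fin.Subset using (Subset; _∈_; ∣_∣)
open import Data.Product using (Σ; ∃; _×_)
open import Relation.Binary.PropositionalEquality using (_≡_; _≢_)
open import Relation.Nullary using (¬_)

-- An edge-colouring of K_n with k colours: a colour for every unordered pair
-- {x,y} (x ≠ y), represented as a symmetric function on ordered pairs.
-- The value on the diagonal (x = x) is irrelevant and never used.
record Coloring (n k : ℕ) : Set where
  field
    col  : Fin n → Fin n → Fin k
    symm : ∀ x y → col x y ≡ col y x
open Coloring public

IndepIn : ∀ {n k} → Coloring n k → Fin k → Subset n → Set
IndepIn f i S = ∀ x y → x ∈ S → y ∈ S → x ≢ y → col f x y ≢ i

αAtLeast : ∀ {n k} → Coloring n k → Fin k → ℕ → Set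
αAtLeast {n} f i m = Σ (Subset n) λ S → IndepIn f i S × m ≤ ∣ S ∣

RProp : (k : ℕ) → (Fin k → ℕ) → ℕ → Set
RProp k ms n = (f : Coloring n k) → ∃ λ i → αAtLeast f i (ms i)

RbarIs : (k : ℕ) → (Fin k → ℕ) → ℕ → Set
RbarIs k ms N = (1 ≤ N) × RProp k ms N × (∀ n → 1 ≤ n → n < N → ¬ RProp k ms n)

RbarDiagIs : ℕ → ℕ → ℕ → Set
RbarDiagIs m k N = RbarIs k (λ _ → m) N

-- Upper bounds: if (N choose 2) < k (c + 1), some colour class of a k-colouring of K_N has at most
-- c edges, and deleting a vertex cover of that class leaves an independent set of its colour.
-- One endpoint per edge is a cover of size c; when N < 2c the handshake lemma gives a vertex
-- of degree at least 2, which saves one more vertex.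
-- Lower bounds: if every colour class of a colouring of K_n contains a matching of t edges, an
-- independent set of any colour misses an endpoint of each of them, so it has at most n - t
-- vertices.  Colouring K_m by the rank of its edges gives R̄(m;k) = m + 1 whenever
-- (m+1 choose 2) < 2k and k ≤ (m choose 2); this covers (i), (ii) and the last part of (iii).
-- R̄(6;8) = 11 and R̄(6;10) = 8 use explicit matching families in K₁₀ and K₇.

module Submission where

open import Defs
open import Data.Nat using (ℕ; _≤_)
open import Data.Product using (_×_)

open import Data.Bool using (Bool; true; false; _∧_; _∨_; if_then_else_)
open import Data.Bool.ListAction using (any)
open import Data.Empty using (⊥-elim)
open import Data.Fin using (Fin; zero; suc; toℕ; fromℕ<; fromℕ; inject₁)
open import Data.Fin.Properties using (_≟_; suc-injective; toℕ-fromℕ<; toℕ<n; all?; ¬∀⟶∃¬)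
open import Data.Fin.Subset using (Subset; inside; outside; ∣_∣; ∁; _-_; _∪_; ⁅_⁆; ⊥) renaming (_∈_ to _∈ˢ_)
open import Data.Fin.Subset.Properties
  using (_∈?_; ∣⊥∣≡0; ∣⁅x⁆∣≡1; ∣p∣≤∣x∷p∣; ∣p∣≤n; ∣∁p∣≡n∸∣p∣; x∈⁅x⁆; x∈p∪q⁺; q⊆p∪q; x∉p⇒x∈∁p; x∈∁p⇒x∉p; x∈p∧x≢y⇒x∈p-y; x∈p⇒∣p-x∣<∣p∣)
open import Data.List using (List; []; _∷_; length; filter; map; _++_; allFin)
open import Data.List.Properties using (length-++; length-map; length-tabulate)
open import Data.List.Membership.Propositional using () renaming (_∈_ to _∈ˡ_)
open import Data.List.Membership.Propositional.Properties using (∈-filter⁺; ∈-map⁺; ∈-++⁺ˡ; ∈-++⁺ʳ; ∈-allFin)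
open import Data.List.Relation.Unary.All as All using (All; []; _∷_)
open import Data.List.Relation.Unary.All.Properties using (filter⁺; ++⁺; map⁺)
open import Data.List.Relation.Unary.AllPairs using (AllPairs; []; _∷_; allPairs?)
open import Data.List.Relation.Unary.Any using (here; there)
open import Data.Nat using (zero; suc; _+_; _*_; _∸_; _<_; _⊓_; _⊔_; _≡ᵇ_; z≤n; s≤s; z<s; s≤s⁻¹; _≤′_; ≤′-refl; ≤′-step; _<?_; _≤?_)
open import Data.Nat.Combinatorics using (_C_; nC1≡n; nCk+nC[k+1]≡[n+1]C[k+1])
open import Data.Nat.DivMod using (_mod_)
open import Data.Nat.Properties
  using ( +-0-commutativeMonoid; ≤-refl; ≤-reflexive; ≤-trans; ≤-antisym; <-trans; ≤-<-trans; <-≤-trans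
        ; <⇒≤; <⇒≢; <⇒≱; ≮⇒≥; ≰⇒>; <⇒≤pred; ≤⇒≤′; n≮0; n<1+n; n≤1+n; m<n⇒m<1+n; m<m+n
        ; +-comm; +-suc; +-identityʳ; *-comm; *-identityʳ; +-mono-≤; +-monoˡ-≤; +-monoʳ-≤; *-monoʳ-≤
        ; m+[n∸m]≡n; m+n∸m≡n; m+n≤o⇒m≤o∸n; ∸-monoˡ-<; ⊓-comm; ⊔-comm; m≤n⇒m⊓n≡m; m≤n⇒m⊔n≡n; module ≤-Reasoning)
open import Algebra.Properties.CommutativeMonoid.Sum +-0-commutativeMonoid
  using (sum-syntax; ∑-distrib-+; sum-cong-≗; sum-replicate-zero)
open import Data.Product as Product using (Σ-syntax; ∃-syntax; _,_; proj₁; proj₂)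
open import Data.Sum as Sum using (_⊎_; inj₁; inj₂; [_,_]′)
open import Data.Vec as Vec using (Vec; []; _∷_; here; there)
open import Function using (_∘_; id)
open import Level using (0ℓ)
open import Relation.Binary.PropositionalEquality
open import Relation.Nullary using (¬_; ¬?; Dec; yes; no; does; _×-dec_)
open import Relation.Nullary.Decidable using (True; toWitness)
open import Relation.Unary using (Pred; Decidable)
open import Relation.Unary.Properties using (_∪?_; ∁?)

private variable
  n k m t : ℕ

-- Graphs, matchings and vertex covers

Edge : ℕ → Set
Edge n = Fin n × Fin n

Proper : Edge n → Set
Proper (x , y) = x ≢ y

Touches : Fin n → Edge n → Set
Touches v (x , y) = x ≡ v ⊎ y ≡ v

touches? : (v : Fin n) → Decidable (Touches v)
touches? v = (λ e → proj₁ e ≟ v) ∪? (λ e → proj₂ e ≟ v)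

VertexDisjoint : Edge n → Edge n → Set
VertexDisjoint (x , y) e = ¬ Touches x e × ¬ Touches y e

IsMatching : List (Edge n) → Set
IsMatching M = All Proper M × AllPairs VertexDisjoint M

isMatching? : (M : List (Edge n)) → Dec (IsMatching M)
isMatching? M = All.all? (λ (x , y) → ¬? (x ≟ y)) M
          ×-dec allPairs? (λ (x , y) e → ¬? (touches? x e) ×-dec ¬? (touches? y e)) M

Meets : Subset n → Edge n → Set
Meets U (x , y) = x ∈ˢ U ⊎ y ∈ˢ U

Covers : Subset n → List (Edge n) → Set
Covers U L = ∀ {e} → e ∈ˡ L → Meets U e

edgeColour : Coloring n k → Edge n → Fin k
edgeColour f (x , y) = col f x y

MonochromaticMatching : Coloring n k → Fin k → List (Edge n) → Set
MonochromaticMatching f i M = IsMatching M × All (λ e → edgeColour f e ≡ i) M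

length-filter-∷ : ∀ {A : Set} {P : Pred A 0ℓ} (P? : Decidable P) x xs →
  length (filter P? (x ∷ xs)) ≡ (if does (P? x) then 1 else 0) + length (filter P? xs)
length-filter-∷ P? x xs with does (P? x)
... | true  = refl
... | false = refl

length-filter-∪ : ∀ {A : Set} {P Q : Pred A 0ℓ} (P? : Decidable P) (Q? : Decidable Q) {xs} →
  All (λ a → ¬ (P a × Q a)) xs → length (filter (P? ∪? Q?) xs) ≡ length (filter P? xs) + length (filter Q? xs)
length-filter-∪ P? Q? [] = refl
length-filter-∪ P? Q? {x ∷ xs} (¬both ∷ rest) with ih ← length-filter-∪ P? Q? rest | P? x | Q? x
... | yes p | yes q = ⊥-elim (¬both (p , q))
... | yes _ | no _  = cong suc ih
... | no _  | yes _ = trans (cong suc ih) (sym (+-suc _ _))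
... | no _  | no _  = ih

length-filter-∁ : ∀ {A : Set} {P : Pred A 0ℓ} (P? : Decidable P) xs →
  length (filter P? xs) + length (filter (∁? P?) xs) ≡ length xs
length-filter-∁ P? [] = refl
length-filter-∁ P? (x ∷ xs) with ih ← length-filter-∁ P? xs | does (P? x)
... | true  = cong suc ih
... | false = trans (+-suc _ _) (cong suc ih)

∑-indicator : (j : Fin k) → ∑[ i < k ] (if does (j ≟ i) then 1 else 0) ≡ 1
∑-indicator {suc k} zero    = cong suc (sum-replicate-zero k)
∑-indicator {suc k} (suc j) = ∑-indicator j

∑-fibres : ∀ {A : Set} (h : A → Fin k) (L : List A) → ∑[ i < k ] length (filter (λ a → h a ≟ i) L) ≡ length L
∑-fibres {k} h [] = sum-replicate-zero k
∑-fibres {k} h (x ∷ L) = begin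
  ∑[ i < k ] length (filter (λ a → h a ≟ i) (x ∷ L))
    ≡⟨ sum-cong-≗ (λ i → length-filter-∷ (λ a → h a ≟ i) x L) ⟩
  ∑[ i < k ] ((if does (h x ≟ i) then 1 else 0) + length (filter (λ a → h a ≟ i) L))
    ≡⟨ ∑-distrib-+ (λ i → if does (h x ≟ i) then 1 else 0) (λ i → length (filter (λ a → h a ≟ i) L)) ⟩
  ∑[ i < k ] (if does (h x ≟ i) then 1 else 0) + ∑[ i < k ] length (filter (λ a → h a ≟ i) L)
    ≡⟨ cong₂ _+_ (∑-indicator (h x)) (∑-fibres h L) ⟩
  suc (length L) ∎
  where open ≡-Reasoning

∑-mono : {f g : Fin k → ℕ} → (∀ i → f i ≤ g i) → ∑[ i < k ] f i ≤ ∑[ i < k ] g i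
∑-mono {zero}  f≤g = z≤n
∑-mono {suc k} f≤g = +-mono-≤ (f≤g zero) (∑-mono (f≤g ∘ suc))

∑-const : ∀ k c → ∑[ i < k ] c ≡ k * c
∑-const zero    c = refl
∑-const (suc k) c = cong (c +_) (∑-const k c)

pigeonhole-below : ∀ (g : Fin k → ℕ) c → ∑[ i < k ] g i < k * suc c → ∃[ i ] g i ≤ c
pigeonhole-below {k} g c small
  with i , ¬c<gi ← ¬∀⟶∃¬ k (λ i → c < g i) (λ i → c <? g i)
                     (λ all-large → <⇒≱ small (subst (_≤ ∑[ i < k ] g i) (∑-const k (suc c)) (∑-mono all-large)))
  = i , ≮⇒≥ ¬c<gi

pigeonhole-above : ∀ (g : Fin k → ℕ) c → k * c < ∑[ i < k ] g i → ∃[ i ] c < g i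
pigeonhole-above {k} g c large
  with i , gi≰c ← ¬∀⟶∃¬ k (λ i → g i ≤ c) (λ i → g i ≤? c)
                    (λ all-small → <⇒≱ large (subst (∑[ i < k ] g i ≤_) (∑-const k c) (∑-mono all-small)))
  = i , ≰⇒> gi≰c

[1+n]C2≡n+nC2 : ∀ n → suc n C 2 ≡ n + n C 2
[1+n]C2≡n+nC2 n = trans (sym (nCk+nC[k+1]≡[n+1]C[k+1] n 1)) (cong (_+ n C 2) (nC1≡n n))

edges : ∀ n → List (Edge n)
edges zero    = []
edges (suc n) = map (λ y → zero , suc y) (allFin n) ++ map (Product.map suc suc) (edges n)

edges-proper : ∀ n → All Proper (edges n)
edges-proper zero    = []
edges-proper (suc n) = ++⁺ (map⁺ (All.tabulate λ _ ())) (map⁺ (All.map (_∘ suc-injective) (edges-proper n)))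

edges-complete : {x y : Fin n} → x ≢ y → (x , y) ∈ˡ edges n ⊎ (y , x) ∈ˡ edges n
edges-complete {x = zero}  {zero}  x≢y = ⊥-elim (x≢y refl)
edges-complete {x = zero}  {suc y} _   = inj₁ (∈-++⁺ˡ (∈-map⁺ (λ y → zero , suc y) (∈-allFin y)))
edges-complete {x = suc x} {zero}  _   = inj₂ (∈-++⁺ˡ (∈-map⁺ (λ y → zero , suc y) (∈-allFin x)))
edges-complete {suc n} {x = suc x} {suc y} x≢y = Sum.map lift lift (edges-complete (x≢y ∘ cong suc))
  where
  lift : ∀ {e} → e ∈ˡ edges n → Product.map suc suc e ∈ˡ edges (suc n)
  lift = ∈-++⁺ʳ (map (λ y → zero , suc y) (allFin n)) ∘ ∈-map⁺ (Product.map suc suc)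

length-edges : ∀ n → length (edges n) ≡ n C 2
length-edges zero    = refl
length-edges (suc n) = begin
  length (map (λ y → zero , suc y) (allFin n) ++ map (Product.map suc suc) (edges n))
    ≡⟨ length-++ (map (λ y → zero , suc y) (allFin n)) ⟩
  length (map (λ y → zero , suc y) (allFin n)) + length (map (Product.map suc suc) (edges n))
    ≡⟨ cong₂ _+_ (trans (length-map _ (allFin n)) (length-tabulate _)) (trans (length-map _ (edges n)) (length-edges n)) ⟩
  n + n C 2
    ≡⟨ [1+n]C2≡n+nC2 n ⟨
  suc n C 2 ∎
  where open ≡-Reasoning

-- Small vertex covers

∣p∪q∣≤∣p∣+∣q∣ : (p q : Subset n) → ∣ p ∪ q ∣ ≤ ∣ p ∣ + ∣ q ∣
∣p∪q∣≤∣p∣+∣q∣ []            []            = z≤n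
∣p∪q∣≤∣p∣+∣q∣ (inside  ∷ p) (x ∷ q)       = s≤s (≤-trans (∣p∪q∣≤∣p∣+∣q∣ p q) (+-monoʳ-≤ ∣ p ∣ (∣p∣≤∣x∷p∣ x q)))
∣p∪q∣≤∣p∣+∣q∣ (outside ∷ p) (inside  ∷ q) = ≤-trans (s≤s (∣p∪q∣≤∣p∣+∣q∣ p q)) (≤-reflexive (sym (+-suc ∣ p ∣ ∣ q ∣)))
∣p∪q∣≤∣p∣+∣q∣ (outside ∷ p) (outside ∷ q) = ∣p∪q∣≤∣p∣+∣q∣ p q

firstEndpoints : List (Edge n) → Subset n
firstEndpoints []            = ⊥
firstEndpoints ((x , _) ∷ L) = ⁅ x ⁆ ∪ firstEndpoints L

firstEndpoints-covers : (L : List (Edge n)) → Covers (firstEndpoints L) L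
firstEndpoints-covers ((x , _) ∷ L) (here refl) = inj₁ (x∈p∪q⁺ (inj₁ (x∈⁅x⁆ x)))
firstEndpoints-covers ((x , _) ∷ L) (there e∈L) =
  Sum.map (q⊆p∪q ⁅ x ⁆ _) (q⊆p∪q ⁅ x ⁆ _) (firstEndpoints-covers L e∈L)

∣firstEndpoints∣≤length : (L : List (Edge n)) → ∣ firstEndpoints L ∣ ≤ length L
∣firstEndpoints∣≤length {n} []    = ≤-reflexive (∣⊥∣≡0 n)
∣firstEndpoints∣≤length ((x , _) ∷ L) =
  ≤-trans (∣p∪q∣≤∣p∣+∣q∣ ⁅ x ⁆ _) (+-mono-≤ (≤-reflexive (∣⁅x⁆∣≡1 x)) (∣firstEndpoints∣≤length L))

VertexCoverBound : ℕ → ℕ → ℕ → Set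
VertexCoverBound n c s = ∀ (L : List (Edge n)) → All Proper L → length L ≤ c → Σ[ U ∈ Subset n ] Covers U L × ∣ U ∣ ≤ s

vertexCoverBound-trivial : ∀ c → VertexCoverBound n c c
vertexCoverBound-trivial c L _ |L|≤c =
  firstEndpoints L , firstEndpoints-covers L , ≤-trans (∣firstEndpoints∣≤length L) |L|≤c

degree : Fin n → List (Edge n) → ℕ
degree v L = length (filter (touches? v) L)

handshake : {L : List (Edge n)} → All Proper L → ∑[ v < n ] degree v L ≡ length L + length L
handshake {n} {L} proper = begin
  ∑[ v < n ] degree v L
    ≡⟨ sum-cong-≗ (λ v → length-filter-∪ (λ e → proj₁ e ≟ v) (λ e → proj₂ e ≟ v)
                   (All.map (λ x≢y (x≡v , y≡v) → x≢y (trans x≡v (sym y≡v))) proper)) ⟩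
  ∑[ v < n ] (length (filter (λ e → proj₁ e ≟ v) L) + length (filter (λ e → proj₂ e ≟ v) L))
    ≡⟨ ∑-distrib-+ (λ v → length (filter (λ e → proj₁ e ≟ v) L)) (λ v → length (filter (λ e → proj₂ e ≟ v) L)) ⟩
  ∑[ v < n ] length (filter (λ e → proj₁ e ≟ v) L) + ∑[ v < n ] length (filter (λ e → proj₂ e ≟ v) L)
    ≡⟨ cong₂ _+_ (∑-fibres proj₁ L) (∑-fibres proj₂ L) ⟩
  length L + length L ∎
  where open ≡-Reasoning

some-vertex-of-degree≥2 : {L : List (Edge n)} → All Proper L → n < length L + length L → ∃[ v ] 1 < degree v L
some-vertex-of-degree≥2 {n} {L} proper n<2|L| =
  pigeonhole-above (λ v → degree v L) 1 (subst₂ _<_ (sym (*-identityʳ n)) (sym (handshake proper)) n<2|L|)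

high-degree-cover : (L : List (Edge n)) (v : Fin n) → 1 < degree v L →
  Σ[ U ∈ Subset n ] Covers U L × ∣ U ∣ ≤ length L ∸ 1
high-degree-cover L v 1<deg = ⁅ v ⁆ ∪ firstEndpoints rest , covers , m+n≤o⇒m≤o∸n _ size
  where
  rest = filter (∁? (touches? v)) L

  covers : Covers (⁅ v ⁆ ∪ firstEndpoints rest) L
  covers {e} e∈L with touches? v e
  ... | yes (inj₁ refl) = inj₁ (x∈p∪q⁺ (inj₁ (x∈⁅x⁆ v)))
  ... | yes (inj₂ refl) = inj₂ (x∈p∪q⁺ (inj₁ (x∈⁅x⁆ v)))
  ... | no ¬touches     = Sum.map (q⊆p∪q ⁅ v ⁆ _) (q⊆p∪q ⁅ v ⁆ _)
                            (firstEndpoints-covers rest (∈-filter⁺ (∁? (touches? v)) e∈L ¬touches))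

  size : ∣ ⁅ v ⁆ ∪ firstEndpoints rest ∣ + 1 ≤ length L
  size = begin
    ∣ ⁅ v ⁆ ∪ firstEndpoints rest ∣ + 1
      ≤⟨ +-monoˡ-≤ 1 (≤-trans (∣p∪q∣≤∣p∣+∣q∣ ⁅ v ⁆ _) (+-mono-≤ (≤-reflexive (∣⁅x⁆∣≡1 v)) (∣firstEndpoints∣≤length rest))) ⟩
    suc (length rest) + 1 ≡⟨ +-comm (suc (length rest)) 1 ⟩
    2 + length rest       ≤⟨ +-monoˡ-≤ (length rest) 1<deg ⟩
    degree v L + length rest ≡⟨ length-filter-∁ (touches? v) L ⟩
    length L ∎
    where open ≤-Reasoning

vertexCoverBound-dense : ∀ {c} → n < 2 * c → VertexCoverBound n c (c ∸ 1)
vertexCoverBound-dense {n} {c} n<2c L proper |L|≤c with length L <? c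
... | yes |L|<c = firstEndpoints L , firstEndpoints-covers L , ≤-trans (∣firstEndpoints∣≤length L) (<⇒≤pred |L|<c)
... | no |L|≮c
  with refl ← ≤-antisym |L|≤c (≮⇒≥ |L|≮c)
  with v , 1<deg ← some-vertex-of-degree≥2 proper (subst (n <_) (cong (c +_) (+-identityʳ c)) n<2c)
  = high-degree-cover L v 1<deg

-- Covers of matchings

meets-without : ∀ {U : Subset n} {u e} → Meets U e → ¬ Touches u e → Meets (U - u) e
meets-without (inj₁ x∈U) ¬t = inj₁ (x∈p∧x≢y⇒x∈p-y x∈U (¬t ∘ inj₁))
meets-without (inj₂ y∈U) ¬t = inj₂ (x∈p∧x≢y⇒x∈p-y y∈U (¬t ∘ inj₂))

met-endpoint-untouched : ∀ {U : Subset n} {e M} → Meets U e → All (VertexDisjoint e) M →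
                         ∃[ u ] u ∈ˢ U × All (¬_ ∘ Touches u) M
met-endpoint-untouched (inj₁ x∈U) disj = _ , x∈U , All.map proj₁ disj
met-endpoint-untouched (inj₂ y∈U) disj = _ , y∈U , All.map proj₂ disj

matching-length≤∣cover∣ : ∀ {M : List (Edge n)} {U} → AllPairs VertexDisjoint M → Covers U M → length M ≤ ∣ U ∣
matching-length≤∣cover∣ [] _ = z≤n
matching-length≤∣cover∣ (disj ∷ disjs) cov
  with u , u∈U , untouched ← met-endpoint-untouched (cov (here refl)) disj
  = ≤-<-trans
      (matching-length≤∣cover∣ disjs (λ e∈M → meets-without (cov (there e∈M)) (All.lookup untouched e∈M)))
      (x∈p⇒∣p-x∣<∣p∣ u∈U)

restrict : Coloring (suc n) k → Coloring n k
restrict f = record { col = λ x y → col f (suc x) (suc y) ; symm = λ x y → symm f (suc x) (suc y) }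

RProp-suc : ∀ {ms : Fin k → ℕ} → RProp k ms n → RProp k ms (suc n)
RProp-suc R f with i , S , indep , ms≤∣S∣ ← R (restrict f) = i , outside ∷ S , indep′ , ms≤∣S∣
  where
  indep′ : IndepIn f i (outside ∷ S)
  indep′ (suc x) (suc y) (there x∈S) (there y∈S) x≢y = indep x y x∈S y∈S (x≢y ∘ cong suc)

RProp-mono : ∀ {ms : Fin k → ℕ} → m ≤ n → RProp k ms m → RProp k ms n
RProp-mono {k} {m} {ms = ms} m≤n = go (≤⇒≤′ m≤n)
  where
  go : ∀ {n} → m ≤′ n → RProp k ms m → RProp k ms n
  go ≤′-refl       = id
  go (≤′-step m≤n) = RProp-suc ∘ go m≤n

RbarIs-intro : ∀ {ms : Fin k → ℕ} → RProp k ms (suc n) → ¬ RProp k ms n → RbarIs k ms (suc n)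
RbarIs-intro R ¬R = s≤s z≤n , R , λ m _ m<1+n → ¬R ∘ RProp-mono (s≤s⁻¹ m<1+n)

colourClass : Coloring n k → Fin k → List (Edge n)
colourClass f i = filter (λ e → edgeColour f e ≟ i) (edges _)

complement-of-cover-independent : ∀ {f : Coloring n k} {i U} → Covers U (colourClass f i) → IndepIn f i (∁ U)
complement-of-cover-independent {f = f} {i} cover x y x∈∁U y∈∁U x≢y xy↦i with edges-complete x≢y
... | inj₁ xy∈E = [ x∈∁p⇒x∉p x∈∁U , x∈∁p⇒x∉p y∈∁U ]′ (cover (∈-filter⁺ (λ e → edgeColour f e ≟ i) xy∈E xy↦i))
... | inj₂ yx∈E = [ x∈∁p⇒x∉p y∈∁U , x∈∁p⇒x∉p x∈∁U ]′ (cover (∈-filter⁺ (λ e → edgeColour f e ≟ i) yx∈E (trans (symm f y x) xy↦i)))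

RProp-of-vertexCoverBound : ∀ c s → n C 2 < k * suc c → VertexCoverBound n c s → m + s ≤ n → RProp k (λ _ → m) n
RProp-of-vertexCoverBound {n} {k} {m} c s few-edges bound m+s≤n f
  with i , sparse ← pigeonhole-below (λ i → length (colourClass f i)) c
                      (subst (_< k * suc c) (sym (trans (∑-fibres (edgeColour f) (edges n)) (length-edges n))) few-edges)
  with U , cover , ∣U∣≤s ← bound (colourClass f i) (filter⁺ _ (edges-proper n)) sparse
  = i , ∁ U , complement-of-cover-independent {f = f} cover
  , subst (m ≤_) (sym (∣∁p∣≡n∸∣p∣ U)) (m+n≤o⇒m≤o∸n m (≤-trans (+-monoʳ-≤ m ∣U∣≤s) m+s≤n))

complement-covers-monochromatic : ∀ {f : Coloring n k} {i S M} → IndepIn f i S →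
  All Proper M → All (λ e → edgeColour f e ≡ i) M → Covers (∁ S) M
complement-covers-monochromatic {S = S} indep proper coloured {x , y} e∈M with x ∈? S | y ∈? S
... | no x∉S | _      = inj₁ (x∉p⇒x∈∁p x∉S)
... | yes _  | no y∉S = inj₂ (x∉p⇒x∈∁p y∉S)
... | yes x∈S | yes y∈S = ⊥-elim (indep x y x∈S y∈S (All.lookup proper e∈M) (All.lookup coloured e∈M))

independent+matching≤n : ∀ {f : Coloring n k} {i S M} → IndepIn f i S → MonochromaticMatching f i M →
  ∣ S ∣ + length M ≤ n
independent+matching≤n {n} {f = f} {S = S} {M} indep ((proper , disjoint) , coloured) = begin
  ∣ S ∣ + length M  ≤⟨ +-monoʳ-≤ ∣ S ∣ (matching-length≤∣cover∣ disjoint (complement-covers-monochromatic {f = f} indep proper coloured)) ⟩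
  ∣ S ∣ + ∣ ∁ S ∣   ≡⟨ cong (∣ S ∣ +_) (∣∁p∣≡n∸∣p∣ S) ⟩
  ∣ S ∣ + (n ∸ ∣ S ∣) ≡⟨ m+[n∸m]≡n (∣p∣≤n S) ⟩
  n                 ∎
  where open ≤-Reasoning

EveryColourHasMatching : Coloring n k → ℕ → Set
EveryColourHasMatching {n} {k} f t = ∀ i → Σ[ M ∈ List (Edge n) ] MonochromaticMatching f i M × t ≤ length M

¬RProp-of-matchings : (f : Coloring n k) → EveryColourHasMatching f t → n < m + t → ¬ RProp k (λ _ → m) n
¬RProp-of-matchings f matchings n<m+t R
  with i , S , indep , m≤∣S∣ ← R f
  with M , matching , t≤∣M∣ ← matchings i
  = <⇒≱ n<m+t (≤-trans (+-mono-≤ m≤∣S∣ t≤∣M∣) (independent+matching≤n {f = f} indep matching))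

-- Colouring by rank

minMaxColouring : (ℕ → ℕ → Fin k) → Coloring n k
minMaxColouring g = record
  { col  = λ x y → g (toℕ x ⊓ toℕ y) (toℕ x ⊔ toℕ y)
  ; symm = λ x y → cong₂ g (⊓-comm (toℕ x) (toℕ y)) (⊔-comm (toℕ x) (toℕ y))
  }

minMaxColouring-< : ∀ {g : ℕ → ℕ → Fin k} {x y : Fin n} → toℕ x < toℕ y →
  col (minMaxColouring g) x y ≡ g (toℕ x) (toℕ y)
minMaxColouring-< {g = g} x<y = cong₂ g (m≤n⇒m⊓n≡m (<⇒≤ x<y)) (m≤n⇒m⊔n≡n (<⇒≤ x<y))

clamp : ∀ k → ℕ → Fin (suc k)
clamp zero    _       = zero
clamp (suc k) zero    = zero
clamp (suc k) (suc r) = suc (clamp k r)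

clamp-toℕ : (i : Fin (suc k)) → clamp k (toℕ i) ≡ i
clamp-toℕ {zero}  zero    = refl
clamp-toℕ {suc k} zero    = refl
clamp-toℕ {suc k} (suc i) = cong suc (clamp-toℕ i)

-- The edge {a < b} has rank (b choose 2) + a; the ranks enumerate the edges of K_n by
-- 0, 1, …, (n choose 2) - 1, and ranks beyond k all get colour k.
rankColouring : ∀ n k → Coloring n (suc k)
rankColouring n k = minMaxColouring (λ a b → clamp k (b C 2 + a))

unrank : ∀ n {r} → r < n C 2 → ∃[ a ] ∃[ b ] a < b × b < n × b C 2 + a ≡ r
unrank zero ()
unrank (suc n) {r} r<[1+n]C2 with r <? n C 2
... | yes r<nC2
  with a , b , a<b , b<n , rank≡r ← unrank n r<nC2
  = a , b , a<b , m<n⇒m<1+n b<n , rank≡r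
... | no r≮nC2 = r ∸ n C 2 , n , a<n , n<1+n n , m+[n∸m]≡n (≮⇒≥ r≮nC2)
  where
  a<n : r ∸ n C 2 < n
  a<n = subst (r ∸ n C 2 <_) (m+n∸m≡n (n C 2) n)
          (∸-monoˡ-< (subst (r <_) (trans ([1+n]C2≡n+nC2 n) (+-comm n (n C 2))) r<[1+n]C2) (≮⇒≥ r≮nC2))

rankColouring-hits : suc k ≤ n C 2 → (i : Fin (suc k)) → ∃[ e ] Proper e × edgeColour (rankColouring n k) e ≡ i
rankColouring-hits {k} {n} 1+k≤nC2 i
  with a , b , a<b , b<n , rank≡i ← unrank n (<-≤-trans (toℕ<n i) 1+k≤nC2)
  = (x , y) , (λ x≡y → <⇒≢ x<y (cong toℕ x≡y)) , coloured
  where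
  x y : Fin n
  x = fromℕ< (<-trans a<b b<n)
  y = fromℕ< b<n

  x<y : toℕ x < toℕ y
  x<y = subst₂ _<_ (sym (toℕ-fromℕ< _)) (sym (toℕ-fromℕ< _)) a<b

  coloured : col (rankColouring n k) x y ≡ i
  coloured = begin
    col (rankColouring n k) x y   ≡⟨ minMaxColouring-< {g = λ a b → clamp k (b C 2 + a)} x<y ⟩
    clamp k (toℕ y C 2 + toℕ x)   ≡⟨ cong₂ (λ a b → clamp k (b C 2 + a)) (toℕ-fromℕ< (<-trans a<b b<n)) (toℕ-fromℕ< b<n) ⟩
    clamp k (b C 2 + a)           ≡⟨ cong (clamp k) rank≡i ⟩
    clamp k (toℕ i)               ≡⟨ clamp-toℕ i ⟩
    i ∎
    where open ≡-Reasoning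

rankColouring-matchings : suc k ≤ n C 2 → EveryColourHasMatching (rankColouring n k) 1
rankColouring-matchings 1+k≤nC2 i
  with e , proper , coloured ← rankColouring-hits 1+k≤nC2 i
  = e ∷ [] , (((proper ∷ []) , ([] ∷ [])) , (coloured ∷ [])) , ≤-refl

Rbar≡1+m : ∀ m k → suc m C 2 < 2 * k → k ≤ m C 2 → RbarDiagIs m k (suc m)
Rbar≡1+m m zero    few-edges _       = ⊥-elim (n≮0 few-edges)
Rbar≡1+m m (suc k) few-edges k≤mC2 = RbarIs-intro
  (RProp-of-vertexCoverBound 1 1 (subst (suc m C 2 <_) (*-comm 2 (suc k)) few-edges)
     (vertexCoverBound-trivial 1) (≤-reflexive (+-comm m 1)))
  (¬RProp-of-matchings (rankColouring m k) (rankColouring-matchings k≤mC2) (m<m+n m z<s))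

-- Colourings induced by matching families

firstWhere : (Fin (suc k) → Bool) → Fin (suc k)
firstWhere {zero}  p = zero
firstWhere {suc k} p = if p zero then zero else suc (firstWhere (p ∘ suc))

-- An edge gets the index of the first matching of the family containing it (the last
-- index if there is none).
matchingColouring : (Fin (suc k) → List (Edge n)) → Coloring n (suc k)
matchingColouring {n = n} Ms = minMaxColouring λ a b → firstWhere (λ i → any (joins a b) (Ms i))
  where
  joins : ℕ → ℕ → Edge n → Bool
  joins a b (x , y) = ((toℕ x ≡ᵇ a) ∧ (toℕ y ≡ᵇ b)) ∨ ((toℕ x ≡ᵇ b) ∧ (toℕ y ≡ᵇ a))

everyColourHasMatching? : (f : Coloring n k) (Ms : Fin k → List (Edge n)) (t : ℕ) →
  Dec (∀ i → MonochromaticMatching f i (Ms i) × t ≤ length (Ms i))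
everyColourHasMatching? f Ms t = all? λ i →
  (isMatching? (Ms i) ×-dec All.all? (λ e → edgeColour f e ≟ i) (Ms i)) ×-dec t ≤? length (Ms i)

matchingColouring-certified : (Ms : Fin (suc k) → List (Edge n)) (t : ℕ) →
  {True (everyColourHasMatching? (matchingColouring Ms) Ms t)} → EveryColourHasMatching (matchingColouring Ms) t
matchingColouring-certified Ms t {ok} i = Ms i , toWitness ok i

-- Eight of the nine perfect matchings of the round-robin factorisation of K₁₀ on ℤ₉ ∪ {∞}:
-- matching j consists of {j, ∞} and {j + s, j - s} for s = 1, …, 4.
roundRobin : Fin 8 → List (Edge 10)
roundRobin j = (vertex (toℕ j) , fromℕ 9) ∷ map (λ s → vertex (toℕ j + s) , vertex (toℕ j + 9 ∸ s)) (1 ∷ 2 ∷ 3 ∷ 4 ∷ [])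
  where
  vertex : ℕ → Fin 10
  vertex r = inject₁ (r mod 9)

-- Ten pairs of disjoint edges of K₇ on ℤ₇: the chords {c ± 1} and {c ± 2} around each c, and
-- three pairs of sides of the 7-cycle.
sevenPointMatchings : Fin 10 → List (Edge 7)
sevenPointMatchings = Vec.lookup (Vec.tabulate chords Vec.++ sides)
  where
  vertex : ℕ → Fin 7
  vertex r = r mod 7

  chords : Fin 7 → List (Edge 7)
  chords c = (vertex (toℕ c + 1) , vertex (toℕ c + 6)) ∷ (vertex (toℕ c + 2) , vertex (toℕ c + 5)) ∷ []

  sides : Vec (List (Edge 7)) 3
  sides = ((vertex 0 , vertex 1) ∷ (vertex 2 , vertex 3) ∷ [])
        ∷ ((vertex 1 , vertex 2) ∷ (vertex 3 , vertex 4) ∷ [])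
        ∷ ((vertex 4 , vertex 5) ∷ (vertex 6 , vertex 0) ∷ [])
        ∷ []

Rbar-6-8≡11 : RbarDiagIs 6 8 11
Rbar-6-8≡11 = RbarIs-intro
  (RProp-of-vertexCoverBound 6 5 (n<1+n 55) (vertexCoverBound-dense (n<1+n 11)) ≤-refl)
  (¬RProp-of-matchings (matchingColouring roundRobin) (matchingColouring-certified roundRobin 5) ≤-refl)

Rbar-6-10≡8 : RbarDiagIs 6 10 8
Rbar-6-10≡8 = RbarIs-intro
  (RProp-of-vertexCoverBound 2 2 (n≤1+n 29) (vertexCoverBound-trivial 2) ≤-refl)
  (¬RProp-of-matchings (matchingColouring sevenPointMatchings) (matchingColouring-certified sevenPointMatchings 2) ≤-refl)

theorem6p4 : RbarDiagIs 4 6 5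
    × (∀ k → 8 ≤ k → k ≤ 10 → RbarDiagIs 5 k 6)
    × (RbarDiagIs 6 8 11 × RbarDiagIs 6 10 8 × (∀ k → 11 ≤ k → k ≤ 15 → RbarDiagIs 6 k 7))
theorem6p4 =
    Rbar≡1+m 4 6 (n≤1+n 11) ≤-refl
  , (λ k 8≤k k≤10 → Rbar≡1+m 5 k (*-monoʳ-≤ 2 8≤k) k≤10)
  , (Rbar-6-8≡11 , Rbar-6-10≡8 , λ k 11≤k k≤15 → Rbar≡1+m 6 k (*-monoʳ-≤ 2 11≤k) k≤15)
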